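{- In the randomized two-stage data delivery algorithm with tuning parameter $a$ used in one phase of RLM-sort, no PE sends more than $2r(1+1/a)$ messages during the main data exchange. Moreover, the total number of messages for a single part is at most $p(1+1/r+1/a)$.
   Context: Setting: $p$ PEs each hold $n/p$ elements partitioned into $r$ pieces; the pieces numbered $i$ form part $i$, which has $n/r$ elements (as in a phase of RLM-sort) and must be delivered to PE group $i$ consisting of $p/r$ consecutive PEs, every PE of the group receiving the same amount of data up to rounding (the group's elements are numbered consecutively and each PE of the group is responsible for a contiguous range of these numbers). Randomized algorithm: let $s:=an/(rp)$. A piece of size $x>s$ is broken into $\lfloor x/s\rfloor$ large pieces of size $s$ and one piece of size $x\bmod s$; smaller pieces are small and stay in place. Large pieces are enumerated by a prefix sum and delegated to pseudorandomly chosen PEs via a pseudorandom permutation; within each part the small pieces and delegated large pieces are ordered randomly (using a pseudorandom PE numbering and random local reordering) and enumerated by a prefix sum; each piece is then sent to the one or more PEs of the target group whose responsibility range intersects the piece's range of element numbers (one message per such target PE). -}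

module Defs where

open import Data.Nat using (ℕ; zero; suc; _+_; _*_; _<_; _<?_; NonZero)
open import Data.Nat.DivMod using (_/_; _%_)
open import Data.Bool using (Bool; true; false; if_then_else_; _∧_)
open import Data.Fin using (Fin; toℕ; _≟_)
import Data.Fin as Fin
open import Data.Fin.Permutation using (Permutation′; _⟨$⟩ʳ_)
open import Data.List using (List; []; _∷_; map; concatMap; length; lookup; replicate; allFin)
open import Data.Nat.ListAction using (sum)
open import Data.Product using (_×_; _,_; proj₁; proj₂)
open import Relation.Nullary.Decidable using (⌊_⌋)
import Data.Nat as ℕ
open import Data.Integer using (+_)
import Data.Rational as ℚ

∑ : (k : ℕ) → (Fin k → ℕ) → ℕ
∑ zero    f = 0
∑ (suc k) f = f Fin.zero + ∑ k (λ i → f (Fin.suc i))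

[_] : Bool → ℕ
[ true ]  = 1
[ false ] = 0

ℕ→ℚ : ℕ → ℚ.ℚ
ℕ→ℚ k = + k ℚ./ 1

largeCount : (s : ℕ) .{{_ : NonZero s}} → ℕ → ℕ
largeCount s x = if ⌊ s <? x ⌋ then x / s else 0

smallSize : (s : ℕ) .{{_ : NonZero s}} → ℕ → ℕ
smallSize s x = if ⌊ s <? x ⌋ then x % s else x

-- Input: x j i = size of piece i on PE j.

-- Large pieces enumerated (prefix-sum order: by PE, then by part);
-- each entry records (origin PE, part).
largePieces : (p r s : ℕ) .{{_ : NonZero s}} → (Fin p → Fin r → ℕ) → List (Fin p × Fin r)
largePieces p r s x =
  concatMap (λ j → concatMap (λ i → replicate (largeCount s (x j i)) (j , i)) (allFin r)) (allFin p)

numLarge : (p r s : ℕ) .{{_ : NonZero s}} → (Fin p → Fin r → ℕ) → ℕ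
numLarge p r s x = length (largePieces p r s x)

-- Delegation: large piece number k goes to PE (π k) mod p.
-- D j i = number of large pieces of part i delegated to PE j.
delegated : (p r s : ℕ) .{{_ : NonZero s}} .{{_ : NonZero p}} (x : Fin p → Fin r → ℕ)
          → Permutation′ (numLarge p r s x) → Fin p → Fin r → ℕ
delegated p r s x π j i =
  ∑ (numLarge p r s x) (λ k →
     [ ⌊ proj₂ (lookup (largePieces p r s x) k) ≟ i ⌋
       ∧ ⌊ toℕ (π ⟨$⟩ʳ k) % p ℕ.≟ toℕ j ⌋ ])

-- The multiset of piece sizes PE j holds for part i after delegation:
-- its own small piece and the large pieces of part i delegated to it.
heldPieces : (p r s : ℕ) .{{_ : NonZero s}} .{{_ : NonZero p}} (x : Fin p → Fin r → ℕ)
           → Permutation′ (numLarge p r s x) → Fin p → Fin r → List ℕ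
heldPieces p r s x π j i =
  smallSize s (x j i) ∷ replicate (delegated p r s x π j i) s

-- Sequence of pieces (owner PE, size) of part i: PEs in the order given by
-- the pseudorandom PE numbering τ, and within each PE in its local order loc j i.
partSeq : (p r : ℕ) → Permutation′ p → (Fin p → Fin r → List ℕ) → Fin r → List (Fin p × ℕ)
partSeq p r τ loc i =
  concatMap (λ t → map (λ y → (τ ⟨$⟩ʳ t , y)) (loc (τ ⟨$⟩ʳ t) i)) (allFin p)

withStarts : {A : Set} → ℕ → List (A × ℕ) → List (A × ℕ × ℕ)
withStarts b []             = []
withStarts b ((o , y) ∷ ps) = (o , b , y) ∷ withStarts (b + y) ps

-- Number of messages for a piece occupying element numbers [b, b+y) of a
-- part delivered to a group of g PEs, the u-th of which (u < g) is
-- responsible for element numbers [u*m, (u+1)*m): one message per target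
-- PE whose range intersects [b, b+y).
messages : (g m b y : ℕ) → ℕ
messages g m b y =
  ∑ g (λ u → [ ⌊ 0 <? y ⌋ ∧ ⌊ b <? suc (toℕ u) * m ⌋ ∧ ⌊ toℕ u * m <? b + y ⌋ ])

sentForPart : (p r g m : ℕ) → Permutation′ p → (Fin p → Fin r → List ℕ) → Fin r → Fin p → ℕ
sentForPart p r g m τ loc i j =
  sum (map (λ { (o , b , y) → if ⌊ o ≟ j ⌋ then messages g m b y else 0 })
           (withStarts 0 (partSeq p r τ loc i)))

sentBy : (p r g m : ℕ) → Permutation′ p → (Fin p → Fin r → List ℕ) → Fin p → ℕ
sentBy p r g m τ loc j = ∑ r (λ i → sentForPart p r g m τ loc i j)

partMessages : (p r g m : ℕ) → Permutation′ p → (Fin p → Fin r → List ℕ) → Fin r → ℕ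
partMessages p r g m τ loc i =
  sum (map (λ { (o , b , y) → messages g m b y }) (withStarts 0 (partSeq p r τ loc i)))

-- A piece occupying element numbers [b, b + y) is sent to the target PEs whose ranges [u m, (u+1) m)
-- meet it.  If y ≤ m these are at most two; in general they are at most one more than the number of
-- ranges starting inside [b, b + y), so along the prefix-sum order of a part the message counts telescope
-- to (number of pieces) + g.  After delegation a PE holds, for each part, one small piece and its
-- delegated large pieces; since large piece k goes to PE (π k mod p), every PE receives at most ⌊m/s⌋
-- large pieces overall, and part i has at most g m / s of them.  With s = a m / r these counts give
-- 2 r (1 + 1/a) messages per PE and p (1 + 1/r + 1/a) messages per part.

module Submission where

open import Defs
import Algebra.Properties.Semiring.Sum
open import Data.Bool using (Bool; true; false; _∧_; if_then_else_)
open import Data.Bool.Properties using (∧-comm)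
open import Data.Fin using (Fin; zero; suc; toℕ; _≟_)
open import Data.Fin.Permutation using (Permutation′; _⟨$⟩ʳ_)
open import Data.Fin.Properties using (toℕ<n; toℕ-injective; suc-injective)
open import Data.List using (List; []; _∷_; _++_; map; length; replicate; concatMap; allFin; tabulate; lookup)
open import Data.List.Properties using (map-++; length-replicate)
open import Data.List.Relation.Binary.Permutation.Propositional using (_↭_; ↭-sym)
open import Data.List.Relation.Binary.Permutation.Propositional.Properties using (↭-length; All-resp-↭)
open import Data.List.Relation.Unary.All using (All; []; _∷_; universal)
open import Data.List.Relation.Unary.All.Properties using (concat⁺; map⁺)
open import Data.Nat using (ℕ; zero; suc; _+_; _*_; _≤_; _<_; z≤n; z<s; NonZero; _<?_; _≤?_)
import Data.Nat as ℕ
open import Data.Nat.DivMod using (_/_; _%_; [m+n]%n≡m%n; m<n⇒m%n≡m; m*n/n≡m; /-monoˡ-≤; m/n*n≤m; m%n≤m)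
open import Data.Nat.ListAction using (sum)
open import Data.Nat.ListAction.Properties using (sum-++)
open import Data.Nat.Properties hiding (_≟_; suc-injective)
open import Data.Product using (_×_; _,_; proj₁; proj₂)
open import Data.Empty using (⊥-elim)
import Data.Integer as ℤ
import Data.Integer.Properties as ℤₚ
open import Data.Nat.Coprimality using (1-coprimeTo) renaming (sym to Coprime-sym)
open import Data.Rational using (mkℚ)
import Data.Rational as ℚ
import Data.Rational.Properties as ℚₚ
open import Data.Rational.Solver using (module +-*-Solver)
open import Data.Nat.Tactic.RingSolver using (solve-∀)
open import Function using (_∘_)
open import Relation.Binary.PropositionalEquality
  using (_≡_; _≗_; refl; sym; trans; cong; cong₂; subst; subst₂; module ≡-Reasoning)
open import Relation.Nullary using (Dec; yes; no; contradiction)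
open import Relation.Nullary.Decidable using (⌊_⌋)

-- Finite sums

module FinSum = Algebra.Properties.Semiring.Sum +-*-semiring
open +-*-Solver using (solve; _:+_; _:*_; _:=_; con)

∑≡sum : ∀ n (f : Fin n → ℕ) → ∑ n f ≡ FinSum.sum f
∑≡sum zero    f = refl
∑≡sum (suc n) f = cong (f zero +_) (∑≡sum n (f ∘ suc))

∑-cong : ∀ n {f g : Fin n → ℕ} → f ≗ g → ∑ n f ≡ ∑ n g
∑-cong zero    eq = refl
∑-cong (suc n) eq = cong₂ _+_ (eq zero) (∑-cong n (eq ∘ suc))

∑-mono-≤ : ∀ n {f g : Fin n → ℕ} → (∀ i → f i ≤ g i) → ∑ n f ≤ ∑ n g
∑-mono-≤ zero    le = z≤n
∑-mono-≤ (suc n) le = +-mono-≤ (le zero) (∑-mono-≤ n (le ∘ suc))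

∑-const : ∀ n c → ∑ n (λ _ → c) ≡ n * c
∑-const zero    c = refl
∑-const (suc n) c = cong (c +_) (∑-const n c)

∑-zero : ∀ n → ∑ n (λ _ → 0) ≡ 0
∑-zero n = trans (∑-const n 0) (*-zeroʳ n)

∑-distrib-+ : ∀ n (f g : Fin n → ℕ) → ∑ n (λ i → f i + g i) ≡ ∑ n f + ∑ n g
∑-distrib-+ n f g = begin
  ∑ n (λ i → f i + g i)          ≡⟨ ∑≡sum n _ ⟩
  FinSum.sum (λ i → f i + g i)   ≡⟨ FinSum.∑-distrib-+ f g ⟩
  FinSum.sum f + FinSum.sum g    ≡⟨ sym (cong₂ _+_ (∑≡sum n f) (∑≡sum n g)) ⟩
  ∑ n f + ∑ n g                  ∎
  where open ≡-Reasoning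

∑-distribˡ-* : ∀ n c (f : Fin n → ℕ) → c * ∑ n f ≡ ∑ n (λ i → c * f i)
∑-distribˡ-* n c f = begin
  c * ∑ n f                    ≡⟨ cong (c *_) (∑≡sum n f) ⟩
  c * FinSum.sum f             ≡⟨ FinSum.*-distribˡ-sum c f ⟩
  FinSum.sum (λ i → c * f i)   ≡⟨ sym (∑≡sum n _) ⟩
  ∑ n (λ i → c * f i)          ∎
  where open ≡-Reasoning

∑-distribʳ-* : ∀ n c (f : Fin n → ℕ) → ∑ n f * c ≡ ∑ n (λ i → f i * c)
∑-distribʳ-* n c f = begin
  ∑ n f * c                    ≡⟨ cong (_* c) (∑≡sum n f) ⟩
  FinSum.sum f * c             ≡⟨ FinSum.*-distribʳ-sum c f ⟩
  FinSum.sum (λ i → f i * c)   ≡⟨ sym (∑≡sum n _) ⟩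
  ∑ n (λ i → f i * c)          ∎
  where open ≡-Reasoning

∑-suc : ∀ n (f : Fin n → ℕ) → ∑ n (λ i → suc (f i)) ≡ n + ∑ n f
∑-suc n f = begin
  ∑ n (λ i → 1 + f i)    ≡⟨ ∑-distrib-+ n (λ _ → 1) f ⟩
  ∑ n (λ _ → 1) + ∑ n f  ≡⟨ cong (_+ ∑ n f) (trans (∑-const n 1) (*-identityʳ n)) ⟩
  n + ∑ n f              ∎
  where open ≡-Reasoning

∑-comm : ∀ n k (f : Fin n → Fin k → ℕ) → ∑ n (λ j → ∑ k (f j)) ≡ ∑ k (λ i → ∑ n (λ j → f j i))
∑-comm zero    k f = sym (∑-zero k)
∑-comm (suc n) k f = trans (cong (∑ k (f zero) +_) (∑-comm n k (f ∘ suc)))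
                           (sym (∑-distrib-+ k (f zero) _))

∑-permute : ∀ n (f : Fin n → ℕ) (π : Permutation′ n) → ∑ n (λ k → f (π ⟨$⟩ʳ k)) ≡ ∑ n f
∑-permute n f π = begin
  ∑ n (λ k → f (π ⟨$⟩ʳ k))          ≡⟨ ∑≡sum n _ ⟩
  FinSum.sum (λ k → f (π ⟨$⟩ʳ k))   ≡⟨ sym (FinSum.∑-permute f π) ⟩
  FinSum.sum f                      ≡⟨ sym (∑≡sum n f) ⟩
  ∑ n f                             ∎
  where open ≡-Reasoning

term≤∑ : ∀ n (f : Fin n → ℕ) i → f i ≤ ∑ n f
term≤∑ (suc n) f zero    = m≤m+n _ _
term≤∑ (suc n) f (suc i) = ≤-trans (term≤∑ n (f ∘ suc) i) (m≤n+m _ _)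

⌊suc≟suc⌋ : ∀ {n} (i j : Fin n) → ⌊ suc i ≟ suc j ⌋ ≡ ⌊ i ≟ j ⌋
⌊suc≟suc⌋ i j with i ≟ j
... | yes _ = refl
... | no _  = refl

∑-select : ∀ n (h : Fin n → ℕ) j → ∑ n (λ i → h i * [ ⌊ i ≟ j ⌋ ]) ≡ h j
∑-select (suc n) h zero    = trans (cong₂ _+_ (*-identityʳ (h zero))
  (trans (∑-cong n (λ i → *-zeroʳ (h (suc i)))) (∑-zero n))) (+-identityʳ (h zero))
∑-select (suc n) h (suc j) = begin
  h zero * 0 + ∑ n (λ i → h (suc i) * [ ⌊ suc i ≟ suc j ⌋ ])
    ≡⟨ cong₂ _+_ (*-zeroʳ (h zero)) (∑-cong n (λ i → cong (λ b → h (suc i) * [ b ]) (⌊suc≟suc⌋ i j))) ⟩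
  ∑ n (λ i → h (suc i) * [ ⌊ i ≟ j ⌋ ])
    ≡⟨ ∑-select n (h ∘ suc) j ⟩
  h (suc j) ∎
  where open ≡-Reasoning

[]≤1 : ∀ b → [ b ] ≤ 1
[]≤1 true  = ≤-refl
[]≤1 false = z≤n

∑-[]≤ : ∀ n (c : Fin n → Bool) → ∑ n (λ i → [ c i ]) ≤ n
∑-[]≤ n c = ≤-trans (∑-mono-≤ n (λ i → []≤1 (c i))) (≤-reflexive (trans (∑-const n 1) (*-identityʳ n)))

[⌊⌋]-mono : {P Q : Set} (P? : Dec P) (Q? : Dec Q) → (P → Q) → [ ⌊ P? ⌋ ] ≤ [ ⌊ Q? ⌋ ]
[⌊⌋]-mono (yes p) (yes _) _   = ≤-refl
[⌊⌋]-mono (yes p) (no ¬q) p⇒q = contradiction (p⇒q p) ¬q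
[⌊⌋]-mono (no _)  _       _   = z≤n

∑-[unique]≤1 : ∀ n {P : Fin n → Set} (P? : ∀ i → Dec (P i)) →
               (∀ {i j} → P i → P j → i ≡ j) → ∑ n (λ i → [ ⌊ P? i ⌋ ]) ≤ 1
∑-[unique]≤1 zero    P? unique = z≤n
∑-[unique]≤1 (suc n) P? unique with P? zero
... | yes P0 = ≤-reflexive (cong suc (trans (∑-cong n absent) (∑-zero n)))
  where
  absent : ∀ i → [ ⌊ P? (suc i) ⌋ ] ≡ 0
  absent i with P? (suc i)
  ... | yes Pi = contradiction (unique P0 Pi) (λ ())
  ... | no _   = refl
... | no _   = ∑-[unique]≤1 n (P? ∘ suc) (λ Pi Pj → suc-injective (unique Pi Pj))

∑-[∧]≤ : ∀ n (b : Bool) (c : Fin n → Bool) →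
         ∑ n (λ i → [ c i ]) ≤ 1 → ∑ n (λ i → [ b ∧ c i ]) ≤ [ b ]
∑-[∧]≤ n true  c ∑c≤1 = ∑c≤1
∑-[∧]≤ n false c _    = ≤-reflexive (∑-zero n)

-- Target PEs reached by one piece

∑ℕ : ℕ → (ℕ → ℕ) → ℕ
∑ℕ k f = ∑ k (λ u → f (toℕ u))

∑ℕ-split : ∀ a b f → ∑ℕ (a + b) f ≡ ∑ℕ a f + ∑ℕ b (λ v → f (a + v))
∑ℕ-split zero    b f = refl
∑ℕ-split (suc a) b f = trans (cong (f 0 +_) (∑ℕ-split a b (f ∘ suc))) (sym (+-assoc (f 0) _ _))

∑ℕ-mono-range : ∀ {a b} f → a ≤ b → ∑ℕ a f ≤ ∑ℕ b f
∑ℕ-mono-range {a} f a≤b with m≤n⇒∃[o]m+o≡n a≤b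
... | o , refl = ≤-trans (m≤m+n _ _) (≤-reflexive (sym (∑ℕ-split a o f)))

module TargetRanges (m : ℕ) where

  startsBefore : ℕ → ℕ → ℕ
  startsBefore k t = ∑ℕ k (λ u → [ ⌊ u * m <? t ⌋ ])

  endsBy : ℕ → ℕ → ℕ
  endsBy k t = ∑ℕ k (λ u → [ ⌊ suc u * m ≤? t ⌋ ])

  startsBefore≤ : ∀ k t → startsBefore k t ≤ k
  startsBefore≤ k t = ∑-[]≤ k _

  startsBefore-mono : ∀ k {t t′} → t ≤ t′ → startsBefore k t ≤ startsBefore k t′
  startsBefore-mono k t≤t′ = ∑-mono-≤ k (λ u → [⌊⌋]-mono (_ <? _) (_ <? _) (λ lt → <-≤-trans lt t≤t′))

  startsBefore≤1+endsBy : ∀ k t → startsBefore k t ≤ 1 + endsBy k t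
  startsBefore≤1+endsBy zero    t = z≤n
  startsBefore≤1+endsBy (suc k) t = +-mono-≤ ([]≤1 _) (begin
    ∑ℕ k (λ u → [ ⌊ suc u * m <? t ⌋ ])  ≤⟨ ∑-mono-≤ k (λ u → [⌊⌋]-mono (_ <? _) (_ ≤? _) <⇒≤) ⟩
    endsBy k t                           ≤⟨ ∑ℕ-mono-range (λ u → [ ⌊ suc u * m ≤? t ⌋ ]) (n≤1+n k) ⟩
    endsBy (suc k) t                     ∎)
    where open ≤-Reasoning

  startsBefore-+ : ∀ k t → startsBefore k (t + m) ≤ 1 + startsBefore k t
  startsBefore-+ zero    t = z≤n
  startsBefore-+ (suc k) t = +-mono-≤ ([]≤1 _) (begin
    ∑ℕ k (λ u → [ ⌊ suc u * m <? t + m ⌋ ])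
      ≤⟨ ∑-mono-≤ k (λ u → [⌊⌋]-mono (_ <? _) (_ <? _) (shift (toℕ u))) ⟩
    startsBefore k t                         ≤⟨ ∑ℕ-mono-range (λ u → [ ⌊ u * m <? t ⌋ ]) (n≤1+n k) ⟩
    startsBefore (suc k) t                   ∎)
    where
    open ≤-Reasoning
    shift : ∀ u → suc u * m < t + m → u * m < t
    shift u lt = +-cancelʳ-< m (u * m) t (subst (_< t + m) (+-comm m (u * m)) lt)

  messages-empty : ∀ k b → messages k m b 0 ≡ 0
  messages-empty k b = ∑-zero k

  ended+messageTo≤started : ∀ b y u → 0 < y →
    [ ⌊ suc u * m ≤? b ⌋ ] + [ ⌊ 0 <? y ⌋ ∧ ⌊ b <? suc u * m ⌋ ∧ ⌊ u * m <? b + y ⌋ ]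
      ≤ [ ⌊ u * m <? b + y ⌋ ]
  ended+messageTo≤started b y u 0<y with 0 <? y
  ... | no ¬0<y = contradiction 0<y ¬0<y
  ... | yes _ with b <? suc u * m
  ...   | yes b<end = ≤-reflexive (cong (_+ [ ⌊ u * m <? b + y ⌋ ]) notEnded)
    where
    notEnded : [ ⌊ suc u * m ≤? b ⌋ ] ≡ 0
    notEnded with suc u * m ≤? b
    ... | yes end≤b = contradiction b<end (≤⇒≯ end≤b)
    ... | no _      = refl
  ...   | no _ = ≤-trans (≤-reflexive (+-identityʳ _)) ([⌊⌋]-mono (_ ≤? _) (_ <? _) started)
    where
    started : suc u * m ≤ b → u * m < b + y
    started end≤b = ≤-<-trans (≤-trans (m≤n+m (u * m) m) end≤b) (m<m+n b 0<y)

  endsBy+messages≤startsBefore : ∀ k b y → 0 < y → endsBy k b + messages k m b y ≤ startsBefore k (b + y)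
  endsBy+messages≤startsBefore k b y 0<y = begin
    endsBy k b + messages k m b y    ≡⟨ sym (∑-distrib-+ k ended message) ⟩
    ∑ k (λ u → ended u + message u)  ≤⟨ ∑-mono-≤ k (λ u → ended+messageTo≤started b y (toℕ u) 0<y) ⟩
    startsBefore k (b + y)           ∎
    where
    open ≤-Reasoning
    ended message : Fin k → ℕ
    ended u = [ ⌊ suc (toℕ u) * m ≤? b ⌋ ]
    message u = [ ⌊ 0 <? y ⌋ ∧ ⌊ b <? suc (toℕ u) * m ⌋ ∧ ⌊ toℕ u * m <? b + y ⌋ ]

  startsBefore+messages : ∀ k b y → startsBefore k b + messages k m b y ≤ 1 + startsBefore k (b + y)
  startsBefore+messages k b zero rewrite messages-empty k b | +-identityʳ b | +-identityʳ (startsBefore k b) =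
    n≤1+n _
  startsBefore+messages k b y@(suc _) = begin
    startsBefore k b + messages k m b y    ≤⟨ +-monoˡ-≤ (messages k m b y) (startsBefore≤1+endsBy k b) ⟩
    1 + (endsBy k b + messages k m b y)    ≤⟨ +-monoʳ-≤ 1 (endsBy+messages≤startsBefore k b y z<s) ⟩
    1 + startsBefore k (b + y)             ∎
    where open ≤-Reasoning

  messages≤2 : ∀ k b y → y ≤ m → messages k m b y ≤ 2
  messages≤2 k b zero      _   = ≤-trans (≤-reflexive (messages-empty k b)) z≤n
  messages≤2 k b y@(suc _) y≤m = +-cancelˡ-≤ (endsBy k b) (messages k m b y) 2 (begin
    endsBy k b + messages k m b y  ≤⟨ endsBy+messages≤startsBefore k b y z<s ⟩
    startsBefore k (b + y)         ≤⟨ startsBefore-mono k (+-monoʳ-≤ b y≤m) ⟩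
    startsBefore k (b + m)         ≤⟨ startsBefore-+ k b ⟩
    1 + startsBefore k b           ≤⟨ +-monoʳ-≤ 1 (startsBefore≤1+endsBy k b) ⟩
    2 + endsBy k b                 ≡⟨ +-comm 2 (endsBy k b) ⟩
    endsBy k b + 2                 ∎)
    where open ≤-Reasoning

-- Messages along the pieces of a part

private variable
  A B : Set

sum-map-++ : (h : A → ℕ) (xs ys : List A) → sum (map h (xs ++ ys)) ≡ sum (map h xs) + sum (map h ys)
sum-map-++ h xs ys = trans (cong sum (map-++ h xs ys)) (sum-++ (map h xs) (map h ys))

sum-map-concatMap : (h : A → ℕ) (F : B → List A) (xs : List B) →
                    sum (map h (concatMap F xs)) ≡ sum (map (λ t → sum (map h (F t))) xs)
sum-map-concatMap h F []       = refl
sum-map-concatMap h F (t ∷ xs) =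
  trans (sum-map-++ h (F t) (concatMap F xs)) (cong (sum (map h (F t)) +_) (sum-map-concatMap h F xs))

sum-map-tabulate : ∀ n (h : A → ℕ) (f : Fin n → A) → sum (map h (tabulate f)) ≡ ∑ n (h ∘ f)
sum-map-tabulate zero    h f = refl
sum-map-tabulate (suc n) h f = cong (h (f zero) +_) (sum-map-tabulate n h (f ∘ suc))

sum-map-concatMap-allFin : ∀ n (h : A → ℕ) (F : Fin n → List A) →
                           sum (map h (concatMap F (allFin n))) ≡ ∑ n (λ t → sum (map h (F t)))
sum-map-concatMap-allFin n h F =
  trans (sum-map-concatMap h F (allFin n)) (sum-map-tabulate n (λ t → sum (map h (F t))) (λ t → t))

sum-map-replicate : (h : A → ℕ) (c : ℕ) (e : A) → sum (map h (replicate c e)) ≡ c * h e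
sum-map-replicate h zero    e = refl
sum-map-replicate h (suc c) e = cong (h e +_) (sum-map-replicate h c e)

length≡sum-map-1 : (xs : List A) → length xs ≡ sum (map (λ _ → 1) xs)
length≡sum-map-1 []       = refl
length≡sum-map-1 (x ∷ xs) = cong suc (length≡sum-map-1 xs)

∑-lookup : (xs : List A) (h : A → ℕ) → ∑ (length xs) (λ k → h (lookup xs k)) ≡ sum (map h xs)
∑-lookup []       h = refl
∑-lookup (x ∷ xs) h = cong (h x +_) (∑-lookup xs h)

ownedBy : ∀ {p} → Fin p → List (Fin p × ℕ) → ℕ
ownedBy j ps = sum (map (λ e → [ ⌊ proj₁ e ≟ j ⌋ ]) ps)

module PieceSequences (g m : ℕ) where
  open TargetRanges m

  -- f abstracts the pattern-matching lambdas of partMessages and sentForPart, which cannot be named here.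
  messages-withStarts≤ : (f : A × ℕ × ℕ → ℕ) → (∀ o b y → f (o , b , y) ≤ messages g m b y) →
    ∀ ps b → startsBefore g b + sum (map f (withStarts b ps)) ≤ length ps + g
  messages-withStarts≤ f f≤ []             b = ≤-trans (≤-reflexive (+-identityʳ _)) (startsBefore≤ g b)
  messages-withStarts≤ f f≤ ((o , y) ∷ ps) b = begin
    startsBefore g b + (f (o , b , y) + rest)    ≡⟨ sym (+-assoc (startsBefore g b) _ rest) ⟩
    startsBefore g b + f (o , b , y) + rest      ≤⟨ +-monoˡ-≤ rest (+-monoʳ-≤ (startsBefore g b) (f≤ o b y)) ⟩
    startsBefore g b + messages g m b y + rest   ≤⟨ +-monoˡ-≤ rest (startsBefore+messages g b y) ⟩
    1 + (startsBefore g (b + y) + rest)          ≤⟨ +-monoʳ-≤ 1 (messages-withStarts≤ f f≤ ps (b + y)) ⟩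
    1 + (length ps + g)                          ∎
    where
    open ≤-Reasoning
    rest = sum (map f (withStarts (b + y) ps))

  ownMessages-withStarts≤ : ∀ {p} (j : Fin p) (f : Fin p × ℕ × ℕ → ℕ) →
    (∀ o b y → f (o , b , y) ≤ (if ⌊ o ≟ j ⌋ then messages g m b y else 0)) →
    ∀ ps b → All (λ e → proj₂ e ≤ m) ps → sum (map f (withStarts b ps)) ≤ 2 * ownedBy j ps
  ownMessages-withStarts≤ j f f≤ []             b []           = z≤n
  ownMessages-withStarts≤ j f f≤ ((o , y) ∷ ps) b (y≤m ∷ ps≤m) = begin
    f (o , b , y) + sum (map f (withStarts (b + y) ps))
      ≤⟨ +-mono-≤ (own (f≤ o b y)) (ownMessages-withStarts≤ j f f≤ ps (b + y) ps≤m) ⟩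
    2 * [ ⌊ o ≟ j ⌋ ] + 2 * ownedBy j ps  ≡⟨ sym (*-distribˡ-+ 2 [ ⌊ o ≟ j ⌋ ] (ownedBy j ps)) ⟩
    2 * ownedBy j ((o , y) ∷ ps)           ∎
    where
    open ≤-Reasoning
    own : ∀ {c} → c ≤ (if ⌊ o ≟ j ⌋ then messages g m b y else 0) → c ≤ 2 * [ ⌊ o ≟ j ⌋ ]
    own c≤ with ⌊ o ≟ j ⌋
    ... | true  = ≤-trans c≤ (messages≤2 g b y y≤m)
    ... | false = c≤

module PartSequence (p r : ℕ) (τ : Permutation′ p) (loc : Fin p → Fin r → List ℕ) where

  sum-map-owner-partSeq : ∀ (h : Fin p → ℕ) i →
    sum (map (h ∘ proj₁) (partSeq p r τ loc i)) ≡ ∑ p (λ j → length (loc j i) * h j)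
  sum-map-owner-partSeq h i = begin
    sum (map (h ∘ proj₁) (partSeq p r τ loc i))
      ≡⟨ sum-map-concatMap-allFin p (h ∘ proj₁) _ ⟩
    ∑ p (λ t → sum (map (h ∘ proj₁) (map (τ ⟨$⟩ʳ t ,_) (loc (τ ⟨$⟩ʳ t) i))))
      ≡⟨ ∑-cong p (λ t → tagged (τ ⟨$⟩ʳ t) (loc (τ ⟨$⟩ʳ t) i)) ⟩
    ∑ p (λ t → length (loc (τ ⟨$⟩ʳ t) i) * h (τ ⟨$⟩ʳ t))
      ≡⟨ ∑-permute p (λ j → length (loc j i) * h j) τ ⟩
    ∑ p (λ j → length (loc j i) * h j) ∎
    where
    open ≡-Reasoning
    tagged : ∀ o ys → sum (map (h ∘ proj₁) (map (o ,_) ys)) ≡ length ys * h o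
    tagged o []       = refl
    tagged o (y ∷ ys) = cong (h o +_) (tagged o ys)

  ownedBy-partSeq : ∀ j i → ownedBy j (partSeq p r τ loc i) ≡ length (loc j i)
  ownedBy-partSeq j i =
    trans (sum-map-owner-partSeq (λ o → [ ⌊ o ≟ j ⌋ ]) i) (∑-select p (λ t → length (loc t i)) j)

  length-partSeq : ∀ i → length (partSeq p r τ loc i) ≡ ∑ p (λ j → length (loc j i))
  length-partSeq i = begin
    length (partSeq p r τ loc i)                ≡⟨ length≡sum-map-1 (partSeq p r τ loc i) ⟩
    sum (map (λ _ → 1) (partSeq p r τ loc i))   ≡⟨ sum-map-owner-partSeq (λ _ → 1) i ⟩
    ∑ p (λ j → length (loc j i) * 1)            ≡⟨ ∑-cong p (λ j → *-identityʳ _) ⟩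
    ∑ p (λ j → length (loc j i))                ∎
    where open ≡-Reasoning

  All-partSeq : ∀ {P : ℕ → Set} i → (∀ j → All P (loc j i)) → All (P ∘ proj₂) (partSeq p r τ loc i)
  All-partSeq i P-loc = concat⁺ (map⁺ (universal (λ t → map⁺ (P-loc (τ ⟨$⟩ʳ t))) (allFin p)))

  module _ (g m : ℕ) where
    open PieceSequences g m

    sentBy≤ : (∀ j i → All (_≤ m) (loc j i)) →
              ∀ j → sentBy p r g m τ loc j ≤ 2 * ∑ r (λ i → length (loc j i))
    sentBy≤ sizes≤m j = begin
      sentBy p r g m τ loc j
        ≤⟨ ∑-mono-≤ r (λ i → ownMessages-withStarts≤ j _ (λ _ _ _ → ≤-refl) (partSeq p r τ loc i) 0
                               (All-partSeq i (λ j′ → sizes≤m j′ i))) ⟩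
      ∑ r (λ i → 2 * ownedBy j (partSeq p r τ loc i))  ≡⟨ ∑-cong r (λ i → cong (2 *_) (ownedBy-partSeq j i)) ⟩
      ∑ r (λ i → 2 * length (loc j i))                 ≡⟨ sym (∑-distribˡ-* r 2 _) ⟩
      2 * ∑ r (λ i → length (loc j i))                 ∎
      where open ≤-Reasoning

    partMessages≤ : ∀ i → partMessages p r g m τ loc i ≤ ∑ p (λ j → length (loc j i)) + g
    partMessages≤ i = begin
      partMessages p r g m τ loc i
        ≤⟨ m≤n+m _ _ ⟩
      TargetRanges.startsBefore m g 0 + partMessages p r g m τ loc i
        ≤⟨ messages-withStarts≤ _ (λ _ _ _ → ≤-refl) (partSeq p r τ loc i) 0 ⟩
      length (partSeq p r τ loc i) + g
        ≡⟨ cong (_+ g) (length-partSeq i) ⟩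
      ∑ p (λ j → length (loc j i)) + g  ∎
      where open ≤-Reasoning

-- Large pieces and their delegation

All-≤-replicate : ∀ {c s m} → c * s ≤ m → All (_≤ m) (replicate c s)
All-≤-replicate {zero}        _      = []
All-≤-replicate {suc c} {s} cs≤m =
  ≤-trans (m≤m+n s (c * s)) cs≤m ∷ All-≤-replicate (≤-trans (m≤n+m (c * s) s) cs≤m)

*≤⇒≤/ : ∀ {k M} s .{{_ : NonZero s}} → k * s ≤ M → k ≤ M / s
*≤⇒≤/ {k} s k*s≤M = ≤-trans (≤-reflexive (sym (m*n/n≡m k s))) (/-monoˡ-≤ s k*s≤M)

∑ℕ-[%≟]≤ : ∀ p .{{_ : NonZero p}} q j → ∑ℕ (q * p) (λ v → [ ⌊ v % p ℕ.≟ j ⌋ ]) ≤ q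
∑ℕ-[%≟]≤ p zero    j = z≤n
∑ℕ-[%≟]≤ p (suc q) j = begin
  ∑ℕ (p + q * p) residue
    ≡⟨ ∑ℕ-split p (q * p) residue ⟩
  ∑ℕ p residue + ∑ℕ (q * p) (λ v → residue (p + v))
    ≡⟨ cong (∑ℕ p residue +_) (∑-cong (q * p) (λ v → periodic (toℕ v))) ⟩
  ∑ℕ p residue + ∑ℕ (q * p) residue
    ≤⟨ +-mono-≤ (∑-[unique]≤1 p (λ u → toℕ u % p ℕ.≟ j) unique) (∑ℕ-[%≟]≤ p q j) ⟩
  suc q  ∎
  where
  open ≤-Reasoning
  residue : ℕ → ℕ
  residue v = [ ⌊ v % p ℕ.≟ j ⌋ ]
  periodic : ∀ v → residue (p + v) ≡ residue v
  periodic v = cong (λ w → [ ⌊ w ℕ.≟ j ⌋ ]) (trans (cong (_% p) (+-comm p v)) ([m+n]%n≡m%n v p))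
  unique : ∀ {u u′ : Fin p} → toℕ u % p ≡ j → toℕ u′ % p ≡ j → u ≡ u′
  unique {u} {u′} u≡j u′≡j = toℕ-injective (begin-equality
    toℕ u       ≡⟨ sym (m<n⇒m%n≡m (toℕ<n u)) ⟩
    toℕ u % p   ≡⟨ trans u≡j (sym u′≡j) ⟩
    toℕ u′ % p  ≡⟨ m<n⇒m%n≡m (toℕ<n u′) ⟩
    toℕ u′      ∎)

largeCount*s≤ : ∀ s .{{_ : NonZero s}} v → largeCount s v * s ≤ v
largeCount*s≤ s v with s <? v
... | yes _ = m/n*n≤m v s
... | no _  = z≤n

smallSize≤ : ∀ s .{{_ : NonZero s}} v → smallSize s v ≤ v
smallSize≤ s v with s <? v
... | yes _ = m%n≤m v s
... | no _  = ≤-refl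

∑-largeCount*s≤ : ∀ s .{{_ : NonZero s}} n (f : Fin n → ℕ) → ∑ n (λ i → largeCount s (f i)) * s ≤ ∑ n f
∑-largeCount*s≤ s n f = ≤-trans (≤-reflexive (∑-distribʳ-* n s _)) (∑-mono-≤ n (λ i → largeCount*s≤ s (f i)))

module Delegation (p r s : ℕ) .{{_ : NonZero p}} .{{_ : NonZero s}} (x : Fin p → Fin r → ℕ) where

  sum-map-largePieces : ∀ (h : Fin p × Fin r → ℕ) →
    sum (map h (largePieces p r s x)) ≡ ∑ p (λ j → ∑ r (λ i → largeCount s (x j i) * h (j , i)))
  sum-map-largePieces h = trans (sum-map-concatMap-allFin p h _) (∑-cong p (λ j →
    trans (sum-map-concatMap-allFin r h _) (∑-cong r (λ i → sum-map-replicate h (largeCount s (x j i)) (j , i)))))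

  numLarge≤ : ∀ {m} → (∀ j → ∑ r (x j) ≤ m) → numLarge p r s x ≤ m / s * p
  numLarge≤ {m} rows≤m = begin
    length (largePieces p r s x)                          ≡⟨ length≡sum-map-1 (largePieces p r s x) ⟩
    sum (map (λ _ → 1) (largePieces p r s x))             ≡⟨ sum-map-largePieces (λ _ → 1) ⟩
    ∑ p (λ j → ∑ r (λ i → largeCount s (x j i) * 1))     ≤⟨ ∑-mono-≤ p perPE ⟩
    ∑ p (λ _ → m / s)                                    ≡⟨ trans (∑-const p (m / s)) (*-comm p (m / s)) ⟩
    m / s * p                                            ∎
    where
    open ≤-Reasoning
    perPE : ∀ j → ∑ r (λ i → largeCount s (x j i) * 1) ≤ m / s
    perPE j = *≤⇒≤/ s (begin
      ∑ r (λ i → largeCount s (x j i) * 1) * s  ≡⟨ cong (_* s) (∑-cong r (λ i → *-identityʳ _)) ⟩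
      ∑ r (λ i → largeCount s (x j i)) * s      ≤⟨ ∑-largeCount*s≤ s r (x j) ⟩
      ∑ r (x j)                                 ≤⟨ rows≤m j ⟩
      m                                         ∎)

  module _ (π : Permutation′ (numLarge p r s x)) where

    private
      L = numLarge p r s x

      partOf : Fin L → Fin r
      partOf k = proj₂ (lookup (largePieces p r s x) k)

      delegatedTo : Fin L → ℕ
      delegatedTo k = toℕ (π ⟨$⟩ʳ k) % p

    ∑-delegated-PE≤ : ∀ {m} → (∀ j → ∑ r (x j) ≤ m) → ∀ j → ∑ r (delegated p r s x π j) ≤ m / s
    ∑-delegated-PE≤ {m} rows≤m j = begin
      ∑ r (λ i → ∑ L (λ k → [ ⌊ partOf k ≟ i ⌋ ∧ toPE k ]))  ≡⟨ ∑-comm r L _ ⟩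
      ∑ L (λ k → ∑ r (λ i → [ ⌊ partOf k ≟ i ⌋ ∧ toPE k ]))  ≤⟨ ∑-mono-≤ L onePart ⟩
      ∑ L (λ k → residue (π ⟨$⟩ʳ k))                       ≡⟨ ∑-permute L residue π ⟩
      ∑ℕ L (λ v → [ ⌊ v % p ℕ.≟ toℕ j ⌋ ])
        ≤⟨ ∑ℕ-mono-range (λ v → [ ⌊ v % p ℕ.≟ toℕ j ⌋ ]) (numLarge≤ rows≤m) ⟩
      ∑ℕ (m / s * p) (λ v → [ ⌊ v % p ℕ.≟ toℕ j ⌋ ])        ≤⟨ ∑ℕ-[%≟]≤ p (m / s) (toℕ j) ⟩
      m / s                                                  ∎
      where
      open ≤-Reasoning
      toPE : Fin L → Bool
      toPE k = ⌊ delegatedTo k ℕ.≟ toℕ j ⌋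
      residue : Fin L → ℕ
      residue k = [ ⌊ toℕ k % p ℕ.≟ toℕ j ⌋ ]
      onePart : ∀ k → ∑ r (λ i → [ ⌊ partOf k ≟ i ⌋ ∧ toPE k ]) ≤ [ toPE k ]
      onePart k = ≤-trans (≤-reflexive (∑-cong r (λ i → cong [_] (∧-comm _ (toPE k)))))
        (∑-[∧]≤ r (toPE k) _ (∑-[unique]≤1 r (partOf k ≟_) (λ e e′ → trans (sym e) e′)))

    ∑-delegated-part≤ : ∀ i → ∑ p (λ j → delegated p r s x π j i) ≤ ∑ p (λ j → largeCount s (x j i))
    ∑-delegated-part≤ i = begin
      ∑ p (λ j → ∑ L (λ k → [ inPart k ∧ ⌊ delegatedTo k ℕ.≟ toℕ j ⌋ ]))  ≡⟨ ∑-comm p L _ ⟩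
      ∑ L (λ k → ∑ p (λ j → [ inPart k ∧ ⌊ delegatedTo k ℕ.≟ toℕ j ⌋ ]))  ≤⟨ ∑-mono-≤ L onePE ⟩
      ∑ L (λ k → [ inPart k ])                                         ≡⟨ ∑-lookup (largePieces p r s x) (λ e → [ ⌊ proj₂ e ≟ i ⌋ ]) ⟩
      sum (map (λ e → [ ⌊ proj₂ e ≟ i ⌋ ]) (largePieces p r s x))      ≡⟨ sum-map-largePieces _ ⟩
      ∑ p (λ j → ∑ r (λ i′ → largeCount s (x j i′) * [ ⌊ i′ ≟ i ⌋ ]))   ≡⟨ ∑-cong p (λ j → ∑-select r (largeCount s ∘ x j) i) ⟩
      ∑ p (λ j → largeCount s (x j i))                                  ∎
      where
      open ≤-Reasoning
      inPart : Fin L → Bool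
      inPart k = ⌊ partOf k ≟ i ⌋
      onePE : ∀ k → ∑ p (λ j → [ inPart k ∧ ⌊ delegatedTo k ℕ.≟ toℕ j ⌋ ]) ≤ [ inPart k ]
      onePE k = ∑-[∧]≤ p (inPart k) _
        (∑-[unique]≤1 p (λ j → delegatedTo k ℕ.≟ toℕ j) (λ e e′ → toℕ-injective (trans (sym e) e′)))

    length-heldPieces : ∀ j i → length (heldPieces p r s x π j i) ≡ suc (delegated p r s x π j i)
    length-heldPieces j i = cong suc (length-replicate (delegated p r s x π j i))

    heldPieces≤ : ∀ {m} j i → x j i ≤ m → delegated p r s x π j i * s ≤ m →
                  All (_≤ m) (heldPieces p r s x π j i)
    heldPieces≤ j i x≤m D*s≤m = ≤-trans (smallSize≤ s (x j i)) x≤m ∷ All-≤-replicate D*s≤m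

module DataExchange (p r g m s : ℕ) .{{_ : NonZero p}} .{{_ : NonZero s}} (x : Fin p → Fin r → ℕ)
  (rows : ∀ j → ∑ r (λ i → x j i) ≡ m) (π : Permutation′ (numLarge p r s x)) (τ : Permutation′ p)
  (loc : Fin p → Fin r → List ℕ) (loc↭held : ∀ j i → loc j i ↭ heldPieces p r s x π j i) where

  open Delegation p r s x
  open PartSequence p r τ loc

  private
    D = delegated p r s x π

    rows≤m : ∀ j → ∑ r (x j) ≤ m
    rows≤m j = ≤-reflexive (rows j)

    length-loc : ∀ j i → length (loc j i) ≡ suc (D j i)
    length-loc j i = trans (↭-length (loc↭held j i)) (length-heldPieces π j i)

  ∑-delegated*s≤m : ∀ j → ∑ r (D j) * s ≤ m
  ∑-delegated*s≤m j = ≤-trans (*-monoˡ-≤ s (∑-delegated-PE≤ π rows≤m j)) (m/n*n≤m m s)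

  loc≤m : ∀ j i → All (_≤ m) (loc j i)
  loc≤m j i = All-resp-↭ (↭-sym (loc↭held j i)) (heldPieces≤ π j i
    (≤-trans (term≤∑ r (x j) i) (rows≤m j))
    (≤-trans (*-monoˡ-≤ s (term≤∑ r (D j) i)) (∑-delegated*s≤m j)))

  sentBy≤-delegated : ∀ j → sentBy p r g m τ loc j ≤ 2 * (r + ∑ r (D j))
  sentBy≤-delegated j = ≤-trans (sentBy≤ g m loc≤m j)
    (≤-reflexive (cong (2 *_) (trans (∑-cong r (length-loc j)) (∑-suc r (D j)))))

  partMessages≤-large : ∀ i → partMessages p r g m τ loc i ≤ p + ∑ p (λ j → largeCount s (x j i)) + g
  partMessages≤-large i = begin
    partMessages p r g m τ loc i              ≤⟨ partMessages≤ g m i ⟩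
    ∑ p (λ j → length (loc j i)) + g
      ≡⟨ cong (_+ g) (trans (∑-cong p (λ j → length-loc j i)) (∑-suc p (λ j → D j i))) ⟩
    p + ∑ p (λ j → D j i) + g                 ≤⟨ +-monoˡ-≤ g (+-monoʳ-≤ p (∑-delegated-part≤ π i)) ⟩
    p + ∑ p (λ j → largeCount s (x j i)) + g  ∎
    where open ≤-Reasoning

-- Converting the counts to the rational bounds

-- Imported only here: in scope above, prefix +_ would make the sections (n +_) ambiguous.
open import Data.Integer using (+_)

ℕ→ℚ≡mkℚ : ∀ k → ℕ→ℚ k ≡ mkℚ (+ k) 0 (Coprime-sym (1-coprimeTo k))
ℕ→ℚ≡mkℚ k = ℚₚ.normalize-coprime (Coprime-sym (1-coprimeTo k))

ℕ→ℚ-+ : ∀ a b → ℕ→ℚ (a + b) ≡ ℕ→ℚ a ℚ.+ ℕ→ℚ b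
ℕ→ℚ-+ a b = trans (cong (ℚ._/ 1) (sym (cong₂ ℤ._+_ (ℤₚ.*-identityʳ (+ a)) (ℤₚ.*-identityʳ (+ b)))))
                  (sym (cong₂ ℚ._+_ (ℕ→ℚ≡mkℚ a) (ℕ→ℚ≡mkℚ b)))

ℕ→ℚ-* : ∀ a b → ℕ→ℚ (a * b) ≡ ℕ→ℚ a ℚ.* ℕ→ℚ b
ℕ→ℚ-* a b = trans (cong (ℚ._/ 1) (ℤₚ.pos-* a b)) (sym (cong₂ ℚ._*_ (ℕ→ℚ≡mkℚ a) (ℕ→ℚ≡mkℚ b)))

ℕ→ℚ-mono-≤ : ∀ {a b} → a ≤ b → ℕ→ℚ a ℚ.≤ ℕ→ℚ b
ℕ→ℚ-mono-≤ {a} {b} a≤b rewrite ℕ→ℚ≡mkℚ a | ℕ→ℚ≡mkℚ b =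
  ℚ.*≤* (subst₂ ℤ._≤_ (sym (ℤₚ.*-identityʳ (+ a))) (sym (ℤₚ.*-identityʳ (+ b))) (ℤ.+≤+ a≤b))

ℕ→ℚ-nonNeg : ∀ k → ℚ.NonNegative (ℕ→ℚ k)
ℕ→ℚ-nonNeg k = subst ℚ.NonNegative (sym (ℕ→ℚ≡mkℚ k)) _

ℕ→ℚ-pos : ∀ k .{{_ : NonZero k}} → ℚ.Positive (ℕ→ℚ k)
ℕ→ℚ-pos (suc k) = subst ℚ.Positive (sym (ℕ→ℚ≡mkℚ (suc k))) _

ℕ→ℚ-*-1/ : ∀ k .{{_ : NonZero k}} → ℕ→ℚ k ℚ.* (+ 1 ℚ./ k) ≡ ℚ.1ℚ
ℕ→ℚ-*-1/ (suc k) = trans (cong₂ ℚ._*_ (ℕ→ℚ≡mkℚ (suc k)) (ℚₚ.normalize-coprime (1-coprimeTo (suc k))))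
                         (ℚₚ.*-inverseʳ (mkℚ (+ suc k) 0 (Coprime-sym (1-coprimeTo (suc k)))))

*ℕ→ℚ-pos⇒nonZero : ∀ k {q a} → ℚ.Positive q → q ≡ a ℚ.* ℕ→ℚ k → NonZero k
*ℕ→ℚ-pos⇒nonZero zero    {a = a} q>0 q≡a*0 =
  ⊥-elim (ℚₚ.<-irrefl refl (ℚₚ.positive⁻¹ ℚ.0ℚ {{subst ℚ.Positive (trans q≡a*0 (ℚₚ.*-zeroʳ a)) q>0}}))
*ℕ→ℚ-pos⇒nonZero (suc k) _ _ = _

module Threshold (p r g m n s : ℕ) .{{_ : NonZero p}} .{{_ : NonZero r}} .{{_ : NonZero s}}
  (p≡rg : p ≡ r * g) (n≡pm : n ≡ p * m) (a : ℚ.ℚ) (a>0 : a ℚ.> ℚ.0ℚ)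
  (s*rp≡a*n : ℕ→ℚ s ℚ.* ℕ→ℚ (r * p) ≡ a ℚ.* ℕ→ℚ n) where

  a⁻¹ : ℚ.ℚ
  a⁻¹ = ℚ.1/_ a {{ℚ.>-nonZero a>0}}

  private instance
    rp≢0 : NonZero (r * p)
    rp≢0 = m*n≢0 r p
    srp≢0 : NonZero (s * (r * p))
    srp≢0 = m*n≢0 s (r * p)
    n≢0 : NonZero n
    n≢0 = *ℕ→ℚ-pos⇒nonZero n {a = a} (ℕ→ℚ-pos (s * (r * p))) (trans (ℕ→ℚ-* s (r * p)) s*rp≡a*n)

  a⁻¹≥0 : ℚ.NonNegative a⁻¹
  a⁻¹≥0 = ℚₚ.pos⇒nonNeg a⁻¹ {{ℚₚ.1/pos⇒pos a {{ℚ.positive a>0}}}}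

  -- s r = a m, so X s ≤ Y m says X ≤ Y r / a.
  *s≤*m⇒≤*r*a⁻¹ : ∀ {X Y} → X * s ≤ Y * m → ℕ→ℚ X ℚ.≤ ℕ→ℚ (Y * r) ℚ.* a⁻¹
  *s≤*m⇒≤*r*a⁻¹ {X} {Y} X*s≤Y*m = begin
    ℕ→ℚ X                    ≡⟨ sym (ℚₚ.*-identityʳ (ℕ→ℚ X)) ⟩
    ℕ→ℚ X ℚ.* ℚ.1ℚ           ≡⟨ cong (ℕ→ℚ X ℚ.*_) (sym (ℚₚ.*-inverseʳ a {{ℚ.>-nonZero a>0}})) ⟩
    ℕ→ℚ X ℚ.* (a ℚ.* a⁻¹)    ≡⟨ sym (ℚₚ.*-assoc (ℕ→ℚ X) a a⁻¹) ⟩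
    ℕ→ℚ X ℚ.* a ℚ.* a⁻¹      ≤⟨ ℚₚ.*-monoʳ-≤-nonNeg a⁻¹ {{a⁻¹≥0}} Xa≤Yr ⟩
    ℕ→ℚ (Y * r) ℚ.* a⁻¹      ∎
    where
    open ℚₚ.≤-Reasoning
    Xs*rp≤Yr*n : X * (s * (r * p)) ≤ Y * r * n
    Xs*rp≤Yr*n = subst₂ _≤_ (*-assoc X s (r * p)) (trans (rearrange Y m r p) (cong (Y * r *_) (sym n≡pm)))
                        (*-monoˡ-≤ (r * p) X*s≤Y*m)
      where
      rearrange : ∀ Y m r p → Y * m * (r * p) ≡ Y * r * (p * m)
      rearrange = solve-∀
    Xan≤Yrn : ℕ→ℚ X ℚ.* a ℚ.* ℕ→ℚ n ℚ.≤ ℕ→ℚ (Y * r) ℚ.* ℕ→ℚ n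
    Xan≤Yrn = begin
      ℕ→ℚ X ℚ.* a ℚ.* ℕ→ℚ n                ≡⟨ ℚₚ.*-assoc (ℕ→ℚ X) a (ℕ→ℚ n) ⟩
      ℕ→ℚ X ℚ.* (a ℚ.* ℕ→ℚ n)              ≡⟨ cong (ℕ→ℚ X ℚ.*_) (sym s*rp≡a*n) ⟩
      ℕ→ℚ X ℚ.* (ℕ→ℚ s ℚ.* ℕ→ℚ (r * p))
        ≡⟨ sym (trans (ℕ→ℚ-* X (s * (r * p))) (cong (ℕ→ℚ X ℚ.*_) (ℕ→ℚ-* s (r * p)))) ⟩
      ℕ→ℚ (X * (s * (r * p)))              ≤⟨ ℕ→ℚ-mono-≤ Xs*rp≤Yr*n ⟩
      ℕ→ℚ (Y * r * n)                      ≡⟨ ℕ→ℚ-* (Y * r) n ⟩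
      ℕ→ℚ (Y * r) ℚ.* ℕ→ℚ n                ∎
    Xa≤Yr : ℕ→ℚ X ℚ.* a ℚ.≤ ℕ→ℚ (Y * r)
    Xa≤Yr = ℚₚ.*-cancelʳ-≤-pos {ℕ→ℚ X ℚ.* a} {ℕ→ℚ (Y * r)} (ℕ→ℚ n) {{ℕ→ℚ-pos n}} Xan≤Yrn

  messagesPerPE≤ : ∀ {N D} → N ≤ 2 * (r + D) → D * s ≤ m →
                   ℕ→ℚ N ℚ.≤ ℕ→ℚ (2 * r) ℚ.* (ℚ.1ℚ ℚ.+ a⁻¹)
  messagesPerPE≤ {N} {D} N≤ D*s≤m = begin
    ℕ→ℚ N
      ≤⟨ ℕ→ℚ-mono-≤ N≤ ⟩
    ℕ→ℚ (2 * (r + D))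
      ≡⟨ trans (ℕ→ℚ-* 2 (r + D)) (cong (ℕ→ℚ 2 ℚ.*_) (ℕ→ℚ-+ r D)) ⟩
    ℕ→ℚ 2 ℚ.* (ℕ→ℚ r ℚ.+ ℕ→ℚ D)
      ≤⟨ ℚₚ.*-monoˡ-≤-nonNeg (ℕ→ℚ 2) {{ℕ→ℚ-nonNeg 2}} (ℚₚ.+-monoʳ-≤ (ℕ→ℚ r) D≤) ⟩
    ℕ→ℚ 2 ℚ.* (ℕ→ℚ r ℚ.+ ℕ→ℚ r ℚ.* a⁻¹)
      ≡⟨ solve 3 (λ t R i → t :* (R :+ R :* i) := t :* R :* (con ℚ.1ℚ :+ i)) refl (ℕ→ℚ 2) (ℕ→ℚ r) a⁻¹ ⟩
    ℕ→ℚ 2 ℚ.* ℕ→ℚ r ℚ.* (ℚ.1ℚ ℚ.+ a⁻¹)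
      ≡⟨ cong (ℚ._* (ℚ.1ℚ ℚ.+ a⁻¹)) (sym (ℕ→ℚ-* 2 r)) ⟩
    ℕ→ℚ (2 * r) ℚ.* (ℚ.1ℚ ℚ.+ a⁻¹)  ∎
    where
    open ℚₚ.≤-Reasoning
    D≤ : ℕ→ℚ D ℚ.≤ ℕ→ℚ r ℚ.* a⁻¹
    D≤ = subst (λ k → ℕ→ℚ D ℚ.≤ ℕ→ℚ k ℚ.* a⁻¹) (*-identityˡ r)
               (*s≤*m⇒≤*r*a⁻¹ {D} {1} (subst (D * s ≤_) (sym (*-identityˡ m)) D*s≤m))

  messagesPerPart≤ : ∀ {N E} → N ≤ p + E + g → E * s ≤ g * m →
                     ℕ→ℚ N ℚ.≤ ℕ→ℚ p ℚ.* (ℚ.1ℚ ℚ.+ (+ 1 ℚ./ r) ℚ.+ a⁻¹)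
  messagesPerPart≤ {N} {E} N≤ E*s≤gm = begin
    ℕ→ℚ N
      ≤⟨ ℕ→ℚ-mono-≤ N≤ ⟩
    ℕ→ℚ (p + E + g)
      ≡⟨ trans (ℕ→ℚ-+ (p + E) g) (cong (ℚ._+ ℕ→ℚ g) (ℕ→ℚ-+ p E)) ⟩
    P ℚ.+ ℕ→ℚ E ℚ.+ ℕ→ℚ g
      ≤⟨ ℚₚ.+-monoˡ-≤ (ℕ→ℚ g) (ℚₚ.+-monoʳ-≤ P E≤) ⟩
    P ℚ.+ P ℚ.* a⁻¹ ℚ.+ ℕ→ℚ g
      ≡⟨ cong (P ℚ.+ P ℚ.* a⁻¹ ℚ.+_) g≡p/r ⟩
    P ℚ.+ P ℚ.* a⁻¹ ℚ.+ P ℚ.* u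
      ≡⟨ solve 3 (λ P i u → P :+ P :* i :+ P :* u := P :* (con ℚ.1ℚ :+ u :+ i)) refl P a⁻¹ u ⟩
    P ℚ.* (ℚ.1ℚ ℚ.+ u ℚ.+ a⁻¹)  ∎
    where
    open ℚₚ.≤-Reasoning
    P = ℕ→ℚ p
    u = + 1 ℚ./ r
    E≤ : ℕ→ℚ E ℚ.≤ P ℚ.* a⁻¹
    E≤ = subst (λ k → ℕ→ℚ E ℚ.≤ ℕ→ℚ k ℚ.* a⁻¹) (trans (*-comm g r) (sym p≡rg))
               (*s≤*m⇒≤*r*a⁻¹ {E} {g} E*s≤gm)
    g≡p/r : ℕ→ℚ g ≡ P ℚ.* u
    g≡p/r = begin-equality
      ℕ→ℚ g                          ≡⟨ sym (ℚₚ.*-identityʳ (ℕ→ℚ g)) ⟩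
      ℕ→ℚ g ℚ.* ℚ.1ℚ                 ≡⟨ cong (ℕ→ℚ g ℚ.*_) (sym (ℕ→ℚ-*-1/ r)) ⟩
      ℕ→ℚ g ℚ.* (ℕ→ℚ r ℚ.* u)
        ≡⟨ solve 3 (λ G R u → G :* (R :* u) := R :* G :* u) refl (ℕ→ℚ g) (ℕ→ℚ r) u ⟩
      ℕ→ℚ r ℚ.* ℕ→ℚ g ℚ.* u          ≡⟨ cong (ℚ._* u) (sym (trans (cong ℕ→ℚ p≡rg) (ℕ→ℚ-* r g))) ⟩
      P ℚ.* u                        ∎

lemmaA2 : (p r g m n s : ℕ) → .{{_ : NonZero p}} → .{{_ : NonZero r}} → .{{_ : NonZero s}}
    → p ≡ r * g → n ≡ p * m
    → (a : ℚ.ℚ) → (a>0 : a ℚ.> ℚ.0ℚ)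
    → ℕ→ℚ s ℚ.* ℕ→ℚ (r * p) ≡ a ℚ.* ℕ→ℚ n
    → (x : Fin p → Fin r → ℕ)
    → (∀ j → ∑ r (λ i → x j i) ≡ m)
    → (∀ i → ∑ p (λ j → x j i) ≡ g * m)
    → (π : Permutation′ (numLarge p r s x))
    → (τ : Permutation′ p)
    → (loc : Fin p → Fin r → List ℕ)
    → (∀ j i → loc j i ↭ heldPieces p r s x π j i)
    → (∀ j → ℕ→ℚ (sentBy p r g m τ loc j)
               ℚ.≤ ℕ→ℚ (2 * r) ℚ.* (ℚ.1ℚ ℚ.+ ℚ.1/_ a {{ℚ.>-nonZero a>0}}))
      Data.Product.× (∀ i → ℕ→ℚ (partMessages p r g m τ loc i)
               ℚ.≤ ℕ→ℚ p ℚ.* (ℚ.1ℚ ℚ.+ (+ 1 ℚ./ r) ℚ.+ ℚ.1/_ a {{ℚ.>-nonZero a>0}}))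
lemmaA2 p r g m n s p≡rg n≡pm a a>0 s*rp≡a*n x rows cols π τ loc loc↭held =
    (λ j → messagesPerPE≤ (sentBy≤-delegated j) (∑-delegated*s≤m j))
  , (λ i → messagesPerPart≤ (partMessages≤-large i)
                            (≤-trans (∑-largeCount*s≤ s p (λ j → x j i)) (≤-reflexive (cols i))))
  where
  open Threshold p r g m n s p≡rg n≡pm a a>0 s*rp≡a*n
  open DataExchange p r g m s x rows π τ loc loc↭held
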